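{- If $c\geq 2$ and $k\geq 1$, then $\mathit{fw}(\mathit{alt}(c, 2k))\geq k(c+2)-1$ and $\mathit{fw}(\mathit{alt}(c, 2k+1))\geq k(c+2)+1$.
   Context: A sequence $s$ contains a sequence $u$ if some subsequence of $s$ can be changed into $u$ by a one-to-one renaming of its letters. An $(r,s)$-formation is a concatenation of $s$ permutations of the same set of $r$ distinct letters. The formation width $\mathit{fw}(u)$ is the minimum $s$ such that there exists $r$ for which every $(r,s)$-formation contains $u$. $I_c$ denotes $1\,2\ldots c$, $D_c$ denotes $c\,(c-1)\ldots 1$, and $\mathit{alt}(c,k)$ is the concatenation of $k$ blocks starting with $I_c$ and alternating between $I_c$ and $D_c$ (e.g. $\mathit{alt}(3,3)=123321123$). -}

module Defs where

open import Data.Nat using (ℕ; zero; suc; _≤_)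
open import Data.List using (List; []; _++_; map; upTo; reverse; concat; length)
open import Data.List.Relation.Binary.Sublist.Propositional using (_⊆_)
open import Data.List.Relation.Binary.Permutation.Propositional using (_↭_)
open import Data.List.Relation.Unary.All using (All)
open import Data.List.Relation.Unary.Unique.Propositional using (Unique)
open import Data.Product using (Σ; ∃; _×_)
open import Relation.Binary.PropositionalEquality using (_≡_)
open import Function.Definitions using (Injective)

Seq : Set
Seq = List ℕ

Contains : Seq → Seq → Set
Contains s u = Σ Seq λ t → (t ⊆ s) × Σ (ℕ → ℕ) λ f → Injective _≡_ _≡_ f × (map f t ≡ u)

IsFormation : ℕ → ℕ → Seq → Set
IsFormation r s f =
  Σ Seq λ L → Unique L × (length L ≡ r) ×
  Σ (List Seq) λ blocks → (length blocks ≡ s) × All (_↭ L) blocks × (f ≡ concat blocks)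

-- s "forces" u: there is r such that every (r,s)-formation contains u.
-- fw(u) is the minimum such s.
Forces : Seq → ℕ → Set
Forces u s = ∃ λ r → ∀ f → IsFormation r s f → Contains f u

-- fw(u) ≥ m, i.e. every s in the set whose minimum is fw(u) is ≥ m.
FwAtLeast : Seq → ℕ → Set
FwAtLeast u m = ∀ s → Forces u s → m ≤ s

I : ℕ → Seq
I c = map suc (upTo c)

D : ℕ → Seq
D c = reverse (I c)

altBlocks : ℕ → Seq → Seq → Seq
altBlocks zero    a b = []
altBlocks (suc k) a b = a ++ altBlocks k b a

alt : ℕ → ℕ → Seq
alt c k = altBlocks k (I c) (D c)

-- For every r, call a round c increasing copies of 0 1 … r−1 followed by two
-- decreasing copies r−1 … 1 0.  Then k rounds form an (r, k(c+2))-formation and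
-- k−1 rounds followed by c increasing copies an (r, k(c+2)−2)-formation.  They avoid
-- alt(c,2k+1) and alt(c,2k) respectively, hence so do their prefixes, which are
-- (r,s)-formations for every smaller s.
--
-- An occurrence of alt(c,m) is a word P P̃ P P̃ … where P = q₁ q₂ … has c letters,
-- adjacent ones distinct, and P̃ is its reverse.  A word with d non-ascents needs
-- d+1 increasing copies of 0 … r−1 to embed into, and P P̃ has exactly c
-- non-ascents.  Embedding greedily, each round takes less than one period of P P̃:
-- if q₁ < q₂ the increasing copies cannot take q₂ … q₂ q₁ (c non-ascents) and the
-- decreasing ones then cannot take q₁ q₁ q₂; if q₂ < q₁ the obstructions are
-- q₁ q₂ … q₂ and q₂ q₁ q₁.  What remains of the occurrence after the last round
-- then fits neither into the final c increasing copies (m even) nor into nothing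
-- (m odd).

module Submission where

open import Defs
open import Data.Nat using (ℕ; _≤_; _+_; _*_; _∸_)
open import Data.Product using (_×_)

open import Data.Nat using (zero; suc; _<_; z≤n; s≤s; _≤?_)
open import Data.Nat.Properties
  using (<-isStrictTotalOrder; <-cmp; <-irrefl; <-asym; <⇒≤; ≮⇒≥; suc-injective;
         +-comm; +-assoc; +-suc; +-identityʳ; *-suc; m≤n⇒m⊓n≡m)
open import Data.List
  using (List; []; _∷_; [_]; _++_; _∷ʳ_; map; reverse; concat; replicate;
         length; upTo; downFrom; take; drop)
open import Data.List.Properties
  using (++-assoc; ++-identityʳ; ∷-injectiveˡ; ∷-injectiveʳ; length-++; length-map;
         length-replicate; length-take; length-upTo; map-++; map-replicate;
         map-injective; reverse-++; reverse-map; reverse-upTo; concat-++;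
         concat-concat; take++drop≡id)
open import Data.List.Relation.Binary.Sublist.Propositional
  using (_⊆_; _∷_; ⊆-refl; ⊆-trans; minimum)
  renaming (_∷ʳ_ to _skip∷_)
open import Data.List.Relation.Binary.Sublist.Propositional.Properties
  using (∷ˡ⁻; ++⁺ˡ; ++⁺ʳ)
open import Data.List.Relation.Binary.Permutation.Propositional using (_↭_; ↭-refl)
open import Data.List.Relation.Binary.Permutation.Propositional.Properties
  using (↭-reverse)
open import Data.List.Relation.Unary.All using (All; []; _∷_)
import Data.List.Relation.Unary.All.Properties as All
open import Data.List.Relation.Unary.AllPairs using (AllPairs; []; _∷_)
open import Data.List.Relation.Unary.AllPairs.Properties
  using (applyUpTo⁺₁; applyDownFrom⁺₁)
open import Data.List.Relation.Unary.Linked using (Linked; _∷_)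
import Data.List.Relation.Unary.Linked as Linked
open import Data.List.Relation.Unary.Linked.Properties using (AllPairs⇒Linked)
import Data.List.Relation.Unary.Linked.Properties as Linkedₚ
import Data.List.Relation.Unary.Unique.Propositional.Properties as Unique
open import Data.Product using (Σ; ∃-syntax; _,_)
open import Function using (_∘_; flip)
open import Relation.Binary using (IsStrictTotalOrder; Tri; tri<; tri≈; tri>)
import Relation.Binary.Construct.Flip.EqAndOrd as Flip
open import Relation.Binary.PropositionalEquality
  using (_≡_; _≢_; refl; sym; trans; cong; cong₂; subst; subst₂; module ≡-Reasoning)
open import Relation.Nullary using (¬_; yes; no; contradiction)

open ≡-Reasoning

mirror : {A : Set} → List A → List A
mirror xs = xs ++ reverse xs

module _ {A : Set} where

  mirror-++ : (xs ys : List A) → mirror (xs ++ ys) ≡ xs ++ mirror ys ++ reverse xs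
  mirror-++ xs ys = begin
    (xs ++ ys) ++ reverse (xs ++ ys)        ≡⟨ cong ((xs ++ ys) ++_) (reverse-++ xs ys) ⟩
    (xs ++ ys) ++ reverse ys ++ reverse xs  ≡⟨ ++-assoc xs ys _ ⟩
    xs ++ ys ++ reverse ys ++ reverse xs    ≡⟨ cong (xs ++_) (sym (++-assoc ys (reverse ys) _)) ⟩
    xs ++ mirror ys ++ reverse xs           ∎

  concat-replicate-rotate : ∀ j (xs ys zs : List A) →
    concat (replicate j (xs ++ ys)) ++ xs ++ zs ≡ xs ++ concat (replicate j (ys ++ xs)) ++ zs
  concat-replicate-rotate zero    xs ys zs = refl
  concat-replicate-rotate (suc j) xs ys zs = begin
    ((xs ++ ys) ++ R) ++ xs ++ zs   ≡⟨ ++-assoc (xs ++ ys) R _ ⟩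
    (xs ++ ys) ++ R ++ xs ++ zs     ≡⟨ cong ((xs ++ ys) ++_) (concat-replicate-rotate j xs ys zs) ⟩
    (xs ++ ys) ++ xs ++ R′ ++ zs    ≡⟨ ++-assoc xs ys _ ⟩
    xs ++ ys ++ xs ++ R′ ++ zs      ≡⟨ cong (xs ++_) (sym (++-assoc ys xs _)) ⟩
    xs ++ (ys ++ xs) ++ R′ ++ zs    ≡⟨ cong (xs ++_) (sym (++-assoc (ys ++ xs) R′ zs)) ⟩
    xs ++ ((ys ++ xs) ++ R′) ++ zs  ∎
    where
      R R′ : List A
      R  = concat (replicate j (xs ++ ys))
      R′ = concat (replicate j (ys ++ xs))

  length-concat-replicate : ∀ n (xs : List A) → length (concat (replicate n xs)) ≡ n * length xs
  length-concat-replicate zero    xs = refl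
  length-concat-replicate (suc n) xs =
    trans (length-++ xs) (cong (length xs +_) (length-concat-replicate n xs))

  concat-concat-replicate : ∀ n (xss : List (List A)) →
    concat (concat (replicate n xss)) ≡ concat (replicate n (concat xss))
  concat-concat-replicate n xss =
    trans (sym (concat-concat (replicate n xss))) (cong concat (map-replicate concat n xss))

  prefix-preimage : ∀ {B : Set} (f : A → B) xs {ys zs} → map f xs ≡ ys ++ zs → ∃[ ws ] map f ws ≡ ys
  prefix-preimage f xs       {[]}     _  = [] , refl
  prefix-preimage f (x ∷ xs) {y ∷ ys} eq with prefix-preimage f xs (∷-injectiveʳ eq)
  ... | ws , fws≡ys = x ∷ ws , cong₂ _∷_ (∷-injectiveˡ eq) fws≡ys

  ⊆-overflow : ∀ {xs ys : List A} ws {z vs} →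
    ¬ (ws ∷ʳ z) ⊆ xs → (ws ∷ʳ z ++ vs) ⊆ xs ++ ys → (z ∷ vs) ⊆ ys
  ⊆-overflow {[]}     ws {z} {vs} _ p =
    ⊆-trans (++⁺ˡ ws ⊆-refl) (subst (_⊆ _) (++-assoc ws [ z ] vs) p)
  ⊆-overflow {x ∷ xs} []       ¬fit (refl ∷ _)  = contradiction (refl ∷ minimum xs) ¬fit
  ⊆-overflow {x ∷ xs} (_ ∷ ws) ¬fit (refl ∷ p)  = ⊆-overflow ws (¬fit ∘ (refl ∷_)) p
  ⊆-overflow {x ∷ xs} ws       ¬fit (_ skip∷ p) = ⊆-overflow ws (¬fit ∘ (x skip∷_)) p

  ⊆-iterate : ∀ {h : A} {σ B} → (∀ {G V} → (h ∷ σ ++ V) ⊆ B ++ G → (h ∷ V) ⊆ G) →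
    ∀ j {G V} → (h ∷ concat (replicate j σ) ++ V) ⊆ concat (replicate j B) ++ G → (h ∷ V) ⊆ G
  ⊆-iterate round zero p = p
  ⊆-iterate {h} {σ} {B} round (suc j) {G} {V} p =
    ⊆-iterate round j (round (subst₂ _⊆_ (cong (h ∷_) (++-assoc σ _ V)) (++-assoc B _ G) p))

module Breaks {A : Set} {_≺_ : A → A → Set} (≺-isStrictTotalOrder : IsStrictTotalOrder _≡_ _≺_) where

  open IsStrictTotalOrder ≺-isStrictTotalOrder using (compare; irrefl) renaming (_<?_ to _≺?_)

  break : A → A → ℕ
  break x y with x ≺? y
  ... | yes _ = 0
  ... | no  _ = 1

  breaks : List A → ℕ
  breaks []           = 0
  breaks (x ∷ [])     = 0
  breaks (x ∷ y ∷ xs) = break x y + breaks (y ∷ xs)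

  break-≺ : ∀ {x y} → x ≺ y → break x y ≡ 0
  break-≺ {x} {y} x≺y with x ≺? y
  ... | yes _   = refl
  ... | no  x⊀y = contradiction x≺y x⊀y

  break-⊀ : ∀ {x y} → ¬ x ≺ y → break x y ≡ 1
  break-⊀ {x} {y} x⊀y with x ≺? y
  ... | yes x≺y = contradiction x≺y x⊀y
  ... | no  _   = refl

  break-refl : ∀ {x} → break x x ≡ 1
  break-refl = break-⊀ (irrefl refl)

  break-flip : ∀ {x y} → x ≢ y → break x y + break y x ≡ 1
  break-flip {x} {y} x≢y = by-trichotomy (compare x y)
    where
      by-trichotomy : Tri (x ≺ y) (x ≡ y) (y ≺ x) → break x y + break y x ≡ 1
      by-trichotomy (tri< x≺y _   y⊀x) = cong₂ _+_ (break-≺ x≺y) (break-⊀ y⊀x)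
      by-trichotomy (tri≈ _   x≡y _  ) = contradiction x≡y x≢y
      by-trichotomy (tri> x⊀y _   y≺x) = cong₂ _+_ (break-⊀ x⊀y) (break-≺ y≺x)

  breaks-∷ʳ : ∀ xs x y → breaks (xs ∷ʳ x ∷ʳ y) ≡ breaks (xs ∷ʳ x) + break x y
  breaks-∷ʳ []           x y = +-identityʳ (break x y)
  breaks-∷ʳ (w ∷ [])     x y =
    trans (cong (break w x +_) (breaks-∷ʳ [] x y)) (sym (+-assoc (break w x) 0 _))
  breaks-∷ʳ (w ∷ v ∷ ws) x y =
    trans (cong (break w v +_) (breaks-∷ʳ (v ∷ ws) x y)) (sym (+-assoc (break w v) _ _))

  -- Each adjacent pair x y of xs occurs in mirror xs once as x y and once as y x, and
  -- exactly one of these is a break; the repeated middle letter adds one more.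
  breaks-mirror : ∀ {xs} → Linked _≢_ xs → breaks (mirror xs) ≡ length xs
  breaks-mirror {[]}         _ = refl
  breaks-mirror {x ∷ []}     _ = cong (_+ 0) break-refl
  breaks-mirror {x ∷ y ∷ ys} (x≢y ∷ y∷ys≢) = begin
    breaks (mirror (x ∷ y ∷ ys))                      ≡⟨ cong breaks (mirror-++ [ x ] (y ∷ ys)) ⟩
    breaks (x ∷ mirror (y ∷ ys) ∷ʳ x)                 ≡⟨ cong (λ w → breaks (x ∷ w ∷ʳ x)) (mirror-++ [ y ] ys) ⟩
    break x y + breaks (y ∷ mirror ys ∷ʳ y ∷ʳ x)      ≡⟨ cong (break x y +_) (breaks-∷ʳ (y ∷ mirror ys) y x) ⟩
    break x y + (breaks (y ∷ mirror ys ∷ʳ y) + break y x)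
      ≡⟨ trans (cong (break x y +_) (+-comm _ (break y x))) (sym (+-assoc (break x y) _ _)) ⟩
    (break x y + break y x) + breaks (y ∷ mirror ys ∷ʳ y)
      ≡⟨ cong₂ _+_ (break-flip x≢y) (trans (cong breaks (sym (mirror-++ [ y ] ys))) (breaks-mirror y∷ys≢)) ⟩
    suc (length (y ∷ ys))                             ∎

  breaks-mirror-∷ʳ : ∀ {x xs y} → Linked _≢_ (x ∷ xs) → ¬ x ≺ y →
    breaks (mirror (x ∷ xs) ∷ʳ y) ≡ suc (length (x ∷ xs))
  breaks-mirror-∷ʳ {x} {xs} {y} x∷xs≢ x⊀y = begin
    breaks (mirror (x ∷ xs) ∷ʳ y)             ≡⟨ cong (λ w → breaks (w ∷ʳ y)) (mirror-++ [ x ] xs) ⟩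
    breaks (x ∷ mirror xs ∷ʳ x ∷ʳ y)          ≡⟨ breaks-∷ʳ (x ∷ mirror xs) x y ⟩
    breaks (x ∷ mirror xs ∷ʳ x) + break x y
      ≡⟨ cong₂ _+_ (trans (cong breaks (sym (mirror-++ [ x ] xs))) (breaks-mirror x∷xs≢)) (break-⊀ x⊀y) ⟩
    length (x ∷ xs) + 1                       ≡⟨ +-comm _ 1 ⟩
    suc (length (x ∷ xs))                     ∎

  breaks-∷-mirror : ∀ {x xs y} → Linked _≢_ (x ∷ xs) → ¬ y ≺ x →
    breaks (y ∷ mirror (x ∷ xs)) ≡ suc (length (x ∷ xs))
  breaks-∷-mirror x∷xs≢ y⊀x = cong₂ _+_ (break-⊀ y⊀x) (breaks-mirror x∷xs≢)

  module _ {L : List A} (L↑ : AllPairs _≺_ L) where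

    private
      skip : ∀ {s y ys S R} → All (s ≺_) S → ¬ s ≺ y → (y ∷ ys) ⊆ S ++ R → (y ∷ ys) ⊆ R
      skip []        _   p           = p
      skip (_ ∷ s≺S) s⊀y (_ skip∷ p) = skip s≺S s⊀y p
      skip (s≺y ∷ _) s⊀y (refl ∷ _)  = contradiction s≺y s⊀y

    mutual
      breaks<copies : ∀ {n x xs} → (x ∷ xs) ⊆ concat (replicate n L) → breaks (x ∷ xs) < n
      breaks<copies {zero}  ()
      breaks<copies {suc n} p = s≤s (breaks≤copies L↑ p)

      -- S is the not yet used remainder of the current copy of L.
      breaks≤copies : ∀ {n S x xs} → AllPairs _≺_ S →
        (x ∷ xs) ⊆ S ++ concat (replicate n L) → breaks (x ∷ xs) ≤ n
      breaks≤copies []       p           = <⇒≤ (breaks<copies p)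
      breaks≤copies (_ ∷ S↑) (_ skip∷ p) = breaks≤copies S↑ p
      breaks≤copies {xs = []} (_ ∷ _) (refl ∷ _) = z≤n
      breaks≤copies {S = s ∷ _} {xs = y ∷ _} (s≺S ∷ S↑) (refl ∷ p) with s ≺? y
      ... | yes _   = breaks≤copies S↑ p
      ... | no  s⊀y = breaks<copies (skip s≺S s⊀y p)

module Ascents  = Breaks <-isStrictTotalOrder
module Descents = Breaks (Flip.isStrictTotalOrder <-isStrictTotalOrder)

upTo-increasing : ∀ r → AllPairs _<_ (upTo r)
upTo-increasing r = applyUpTo⁺₁ (λ i → i) r (λ i<j _ → i<j)

downFrom-decreasing : ∀ r → AllPairs (flip _<_) (downFrom r)
downFrom-decreasing r = applyDownFrom⁺₁ (λ i → i) r (λ j<i _ → j<i)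

altBlocks-odd : ∀ j (xs ys : Seq) → altBlocks (1 + 2 * j) xs ys ≡ concat (replicate j (xs ++ ys)) ++ xs
altBlocks-odd zero    xs ys = ++-identityʳ xs
altBlocks-odd (suc j) xs ys = begin
  altBlocks (suc (2 * suc j)) xs ys                    ≡⟨ cong (λ m → altBlocks (suc m) xs ys) (*-suc 2 j) ⟩
  xs ++ ys ++ altBlocks (suc (2 * j)) xs ys            ≡⟨ cong (λ w → xs ++ ys ++ w) (altBlocks-odd j xs ys) ⟩
  xs ++ ys ++ concat (replicate j (xs ++ ys)) ++ xs    ≡⟨ sym (++-assoc xs ys _) ⟩
  (xs ++ ys) ++ concat (replicate j (xs ++ ys)) ++ xs  ≡⟨ sym (++-assoc (xs ++ ys) _ xs) ⟩
  concat (replicate (suc j) (xs ++ ys)) ++ xs          ∎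

altBlocks-even : ∀ j (xs ys : Seq) → altBlocks (2 + 2 * j) xs ys ≡ concat (replicate j (xs ++ ys)) ++ xs ++ ys
altBlocks-even j xs ys = begin
  xs ++ altBlocks (1 + 2 * j) ys xs           ≡⟨ cong (xs ++_) (altBlocks-odd j ys xs) ⟩
  xs ++ concat (replicate j (ys ++ xs)) ++ ys   ≡⟨ sym (concat-replicate-rotate j xs ys ys) ⟩
  concat (replicate j (xs ++ ys)) ++ xs ++ ys   ∎

-- P is the preimage of the leading block I c; injectivity of the renaming fixes the rest.
alt-preimage : ∀ {c m s} → Contains s (alt c (suc m)) →
  ∃[ P ] length P ≡ c × Linked _≢_ P × altBlocks (suc m) P (reverse P) ⊆ s
alt-preimage {c} {m} (t , t⊆s , f , f-inj , ft≡alt) with prefix-preimage f t ft≡alt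
... | P , fP≡I = P , length-P , P≢ , subst (_⊆ _) t≡ t⊆s
  where
    length-P : length P ≡ c
    length-P = trans (sym (length-map f P))
      (trans (cong length fP≡I) (trans (length-map suc (upTo c)) (length-upTo c)))

    I≢ : Linked _≢_ (I c)
    I≢ = AllPairs⇒Linked (Unique.map⁺ suc-injective (Unique.upTo⁺ c))

    P≢ : Linked _≢_ P
    P≢ = Linked.map (λ fx≢fy → fx≢fy ∘ cong f) (Linkedₚ.map⁻ (subst (Linked _≢_) (sym fP≡I) I≢))

    t≡ : t ≡ altBlocks (suc m) P (reverse P)
    t≡ = map-injective f-inj (trans ft≡alt (sym (begin
      map f (altBlocks (suc m) P (reverse P))             ≡⟨ map-altBlocks (suc m) P (reverse P) ⟩
      altBlocks (suc m) (map f P) (map f (reverse P))     ≡⟨ cong (altBlocks (suc m) (map f P)) (reverse-map f P) ⟩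
      altBlocks (suc m) (map f P) (reverse (map f P))     ≡⟨ cong (λ w → altBlocks (suc m) w (reverse w)) fP≡I ⟩
      alt c (suc m)                                       ∎)))
      where
        map-altBlocks : ∀ k xs ys → map f (altBlocks k xs ys) ≡ altBlocks k (map f xs) (map f ys)
        map-altBlocks zero    xs ys = refl
        map-altBlocks (suc k) xs ys = trans (map-++ f xs _) (cong (map f xs ++_) (map-altBlocks k ys xs))

contains-alt⁻ : ∀ {c m s} → 2 ≤ c → Contains s (alt c (suc m)) →
  ∃[ q₁ ] ∃[ q₂ ] ∃[ ps ] length (q₁ ∷ q₂ ∷ ps) ≡ c × Linked _≢_ (q₁ ∷ q₂ ∷ ps) ×
    altBlocks (suc m) (q₁ ∷ q₂ ∷ ps) (reverse (q₁ ∷ q₂ ∷ ps)) ⊆ s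
contains-alt⁻ {m = m} 2≤c occ with alt-preimage {m = m} occ
... | q₁ ∷ q₂ ∷ ps , length-P , P≢ , alt⊆s = q₁ , q₂ , ps , length-P , P≢ , alt⊆s
... | []           , refl     , _         = contradiction 2≤c λ ()
... | _ ∷ []       , refl     , _         = contradiction 2≤c λ { (s≤s ()) }

ascendingRun : ℕ → ℕ → Seq
ascendingRun c r = concat (replicate c (upTo r))

descendingRun : ℕ → Seq
descendingRun r = concat (replicate 2 (downFrom r))

module Occurrence (r : ℕ) {c q₁ q₂ : ℕ} {ps : List ℕ}
                  (length-P : length (q₁ ∷ q₂ ∷ ps) ≡ c) (P≢ : Linked _≢_ (q₁ ∷ q₂ ∷ ps)) where

  private
    P P′ Z Ups Downs Round : Seq
    P     = q₁ ∷ q₂ ∷ ps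
    P′    = q₂ ∷ ps
    Z     = ps ++ reverse P   -- so that mirror P = q₁ ∷ q₂ ∷ Z definitionally
    Ups   = ascendingRun c r
    Downs = descendingRun r
    Round = Ups ++ Downs

    q₂∷Z≡ : q₂ ∷ Z ≡ mirror P′ ∷ʳ q₁
    q₂∷Z≡ = ∷-injectiveʳ (mirror-++ [ q₁ ] P′)

    up-Ups : q₁ < q₂ → ¬ (mirror P′ ∷ʳ q₁) ⊆ Ups
    up-Ups q₁<q₂ p =
      <-irrefl (trans (Ascents.breaks-mirror-∷ʳ (Linked.tail P≢) (<-asym q₁<q₂)) length-P)
               (Ascents.breaks<copies (upTo-increasing r) p)

    down-Ups : q₂ < q₁ → ¬ (q₁ ∷ mirror P′) ⊆ Ups
    down-Ups q₂<q₁ p =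
      <-irrefl (trans (Ascents.breaks-∷-mirror (Linked.tail P≢) (<-asym q₂<q₁)) length-P)
               (Ascents.breaks<copies (upTo-increasing r) p)

    up-Downs : q₁ < q₂ → ¬ (q₁ ∷ q₁ ∷ q₂ ∷ []) ⊆ Downs
    up-Downs q₁<q₂ p =
      <-irrefl (cong₂ _+_ (Descents.break-refl {q₁}) (cong (_+ 0) (Descents.break-⊀ {q₁} {q₂} (<-asym q₁<q₂))))
               (Descents.breaks<copies (downFrom-decreasing r) p)

    down-Downs : q₂ < q₁ → ¬ (q₂ ∷ q₁ ∷ q₁ ∷ []) ⊆ Downs
    down-Downs q₂<q₁ p =
      <-irrefl (cong₂ _+_ (Descents.break-⊀ {q₂} {q₁} (<-asym q₂<q₁)) (cong (_+ 0) (Descents.break-refl {q₁})))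
               (Descents.breaks<copies (downFrom-decreasing r) p)

    up-round : q₁ < q₂ → ∀ {G V} → (q₂ ∷ (Z ++ q₁ ∷ q₂ ∷ []) ++ V) ⊆ Round ++ G → (q₂ ∷ V) ⊆ G
    up-round q₁<q₂ {G} {V} p =
      ⊆-overflow (q₁ ∷ q₁ ∷ []) (up-Downs q₁<q₂)
        (⊆-overflow (mirror P′) (up-Ups q₁<q₂) (subst₂ _⊆_ word (++-assoc Ups Downs G) p))
      where
        word : q₂ ∷ (Z ++ q₁ ∷ q₂ ∷ []) ++ V ≡ mirror P′ ∷ʳ q₁ ++ q₁ ∷ q₂ ∷ V
        word = trans (cong (q₂ ∷_) (++-assoc Z _ V)) (cong (_++ q₁ ∷ q₂ ∷ V) q₂∷Z≡)

    down-round : q₂ < q₁ → ∀ {G V} → (q₁ ∷ (q₂ ∷ Z ++ q₁ ∷ []) ++ V) ⊆ Round ++ G → (q₁ ∷ V) ⊆ G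
    down-round q₂<q₁ {G} {V} p =
      ⊆-overflow (q₂ ∷ q₁ ∷ []) (down-Downs q₂<q₁)
        (⊆-overflow (q₁ ∷ q₂ ∷ mirror ps) (down-Ups q₂<q₁ ∘ subst (_⊆ Ups) (cong (q₁ ∷_) (sym P′-mirror)))
          (subst₂ _⊆_ word (++-assoc Ups Downs G) p))
      where
        P′-mirror : mirror P′ ≡ q₂ ∷ mirror ps ∷ʳ q₂
        P′-mirror = mirror-++ [ q₂ ] ps

        word : q₁ ∷ (q₂ ∷ Z ++ q₁ ∷ []) ++ V ≡ q₁ ∷ q₂ ∷ mirror ps ∷ʳ q₂ ++ q₁ ∷ q₁ ∷ V
        word = begin
          q₁ ∷ (q₂ ∷ Z ++ q₁ ∷ []) ++ V         ≡⟨ cong (q₁ ∷_) (++-assoc (q₂ ∷ Z) [ q₁ ] V) ⟩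
          q₁ ∷ (q₂ ∷ Z) ++ q₁ ∷ V               ≡⟨ cong (λ w → q₁ ∷ w ++ q₁ ∷ V) q₂∷Z≡ ⟩
          q₁ ∷ (mirror P′ ∷ʳ q₁) ++ q₁ ∷ V      ≡⟨ cong (q₁ ∷_) (++-assoc (mirror P′) [ q₁ ] (q₁ ∷ V)) ⟩
          q₁ ∷ mirror P′ ++ q₁ ∷ q₁ ∷ V         ≡⟨ cong (λ w → q₁ ∷ w ++ q₁ ∷ q₁ ∷ V) P′-mirror ⟩
          q₁ ∷ q₂ ∷ mirror ps ∷ʳ q₂ ++ q₁ ∷ q₁ ∷ V ∎

    up-rounds : q₁ < q₂ → ∀ j {G T} →
      (concat (replicate j (mirror P)) ++ q₁ ∷ q₂ ∷ T) ⊆ concat (replicate j Round) ++ G → (q₂ ∷ T) ⊆ G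
    up-rounds q₁<q₂ j {T = T} p =
      ⊆-iterate (up-round q₁<q₂) j (∷ˡ⁻ (subst (_⊆ _) (concat-replicate-rotate j (q₁ ∷ q₂ ∷ []) Z T) p))

    down-rounds : q₂ < q₁ → ∀ j {G T} →
      (concat (replicate j (mirror P)) ++ q₁ ∷ T) ⊆ concat (replicate j Round) ++ G → (q₁ ∷ T) ⊆ G
    down-rounds q₂<q₁ j {T = T} p =
      ⊆-iterate (down-round q₂<q₁) j (subst (_⊆ _) (concat-replicate-rotate j [ q₁ ] (q₂ ∷ Z) T) p)

  even-impossible : ∀ j → ¬ (concat (replicate j (mirror P)) ++ mirror P) ⊆ concat (replicate j Round) ++ Ups
  even-impossible j p with <-cmp q₁ q₂
  ... | tri< q₁<q₂ _ _ = up-Ups q₁<q₂ (subst (_⊆ Ups) q₂∷Z≡ (up-rounds q₁<q₂ j p))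
  ... | tri≈ _ q₁≡q₂ _ = Linked.head P≢ q₁≡q₂
  ... | tri> _ _ q₂<q₁ =
    down-Ups q₂<q₁ (⊆-trans (++⁺ʳ [ q₁ ] ⊆-refl) (subst (_⊆ Ups) (cong (q₁ ∷_) q₂∷Z≡) (down-rounds q₂<q₁ j p)))

  odd-impossible : ∀ j → ¬ (concat (replicate j (mirror P)) ++ P) ⊆ concat (replicate j Round)
  odd-impossible j p with <-cmp q₁ q₂
  ... | tri< q₁<q₂ _ _ with up-rounds q₁<q₂ j (subst (_ ⊆_) (sym (++-identityʳ _)) p)
  ...   | ()
  odd-impossible j p | tri≈ _ q₁≡q₂ _ = Linked.head P≢ q₁≡q₂
  odd-impossible j p | tri> _ _ q₂<q₁ with down-rounds q₂<q₁ j (subst (_ ⊆_) (sym (++-identityʳ _)) p)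
  ...   | ()

roundBlocks : ℕ → ℕ → List Seq
roundBlocks c r = replicate c (upTo r) ++ replicate 2 (downFrom r)

concat-roundBlocks : ∀ c r → concat (roundBlocks c r) ≡ ascendingRun c r ++ descendingRun r
concat-roundBlocks c r = sym (concat-++ (replicate c (upTo r)) (replicate 2 (downFrom r)))

length-roundBlocks : ∀ c r → length (roundBlocks c r) ≡ c + 2
length-roundBlocks c r =
  trans (length-++ (replicate c (upTo r))) (cong₂ _+_ (length-replicate c) (length-replicate 2 {downFrom r}))

roundBlocks-↭ : ∀ c r → All (_↭ upTo r) (roundBlocks c r)
roundBlocks-↭ c r = All.++⁺ (All.replicate⁺ c ↭-refl) (All.replicate⁺ 2 downFrom↭upTo)
  where
    downFrom↭upTo : downFrom r ↭ upTo r
    downFrom↭upTo = subst (_↭ upTo r) (reverse-upTo r) (↭-reverse (upTo r))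

concat-rounds : ∀ c r j →
  concat (concat (replicate j (roundBlocks c r))) ≡ concat (replicate j (ascendingRun c r ++ descendingRun r))
concat-rounds c r j =
  trans (concat-concat-replicate j (roundBlocks c r)) (cong (λ w → concat (replicate j w)) (concat-roundBlocks c r))

length-rounds : ∀ c r j → length (concat (replicate j (roundBlocks c r))) ≡ j * (c + 2)
length-rounds c r j =
  trans (length-concat-replicate j (roundBlocks c r)) (cong (j *_) (length-roundBlocks c r))

rounds-↭ : ∀ c r j → All (_↭ upTo r) (concat (replicate j (roundBlocks c r)))
rounds-↭ c r j = All.concat⁺ (All.replicate⁺ j (roundBlocks-↭ c r))

AvoidingFormation : ℕ → ℕ → Seq → Set
AvoidingFormation r m u = Σ (List Seq) λ blocks →
  length blocks ≡ m × All (_↭ upTo r) blocks × ¬ Contains (concat blocks) u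

Contains-⊆ : ∀ {s s′ u} → s ⊆ s′ → Contains s u → Contains s′ u
Contains-⊆ s⊆s′ (t , t⊆s , f-renames) = t , ⊆-trans t⊆s s⊆s′ , f-renames

-- A formation with s ≤ m blocks is a prefix of the avoiding one.
avoiding⇒FwAtLeast : ∀ {m u} → (∀ r → AvoidingFormation r m u) → FwAtLeast u (suc m)
avoiding⇒FwAtLeast {m} avoiding s (r , forces) with suc m ≤? s | avoiding r
... | yes m<s | _ = m<s
... | no  m≮s | blocks , length≡m , blocks↭ , avoids =
  contradiction (Contains-⊆ prefix⊆ (forces _ prefix-formation)) avoids
  where
    prefix-formation : IsFormation r s (concat (take s blocks))
    prefix-formation =
      upTo r , Unique.upTo⁺ r , length-upTo r , take s blocks ,
      trans (length-take s blocks) (m≤n⇒m⊓n≡m (subst (s ≤_) (sym length≡m) (≮⇒≥ m≮s))) ,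
      All.take⁺ s blocks↭ , refl

    prefix⊆ : concat (take s blocks) ⊆ concat blocks
    prefix⊆ = subst (concat (take s blocks) ⊆_)
      (trans (concat-++ (take s blocks) (drop s blocks)) (cong concat (take++drop≡id s blocks)))
      (++⁺ʳ _ ⊆-refl)

alt-even-avoided : ∀ {c} → 2 ≤ c → ∀ j r → AvoidingFormation r (j * (c + 2) + c) (alt c (2 * suc j))
alt-even-avoided {c} 2≤c j r =
  blocks , length-blocks , All.++⁺ (rounds-↭ c r j) (All.replicate⁺ c ↭-refl) , avoids
  where
    blocks : List Seq
    blocks = concat (replicate j (roundBlocks c r)) ++ replicate c (upTo r)

    length-blocks : length blocks ≡ j * (c + 2) + c
    length-blocks = trans (length-++ (concat (replicate j (roundBlocks c r))))
                          (cong₂ _+_ (length-rounds c r j) (length-replicate c {upTo r}))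

    concat-blocks : concat blocks ≡ concat (replicate j (ascendingRun c r ++ descendingRun r)) ++ ascendingRun c r
    concat-blocks = trans (sym (concat-++ (concat (replicate j (roundBlocks c r))) _))
                          (cong (_++ ascendingRun c r) (concat-rounds c r j))

    avoids : ¬ Contains (concat blocks) (alt c (2 * suc j))
    avoids occ with contains-alt⁻ {m = 1 + 2 * j} 2≤c (subst (Contains _) (cong (alt c) (*-suc 2 j)) occ)
    ... | q₁ , q₂ , ps , length-P , P≢ , alt⊆ =
      Occurrence.even-impossible r length-P P≢ j (subst₂ _⊆_ (altBlocks-even j P (reverse P)) concat-blocks alt⊆)
      where P = q₁ ∷ q₂ ∷ ps

alt-odd-avoided : ∀ {c} → 2 ≤ c → ∀ j r → AvoidingFormation r (j * (c + 2)) (alt c (2 * j + 1))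
alt-odd-avoided {c} 2≤c j r = blocks , length-rounds c r j , rounds-↭ c r j , avoids
  where
    blocks : List Seq
    blocks = concat (replicate j (roundBlocks c r))

    avoids : ¬ Contains (concat blocks) (alt c (2 * j + 1))
    avoids occ with contains-alt⁻ {m = 2 * j} 2≤c (subst (Contains _) (cong (alt c) (+-comm (2 * j) 1)) occ)
    ... | q₁ , q₂ , ps , length-P , P≢ , alt⊆ =
      Occurrence.odd-impossible r length-P P≢ j (subst₂ _⊆_ (altBlocks-odd j P (reverse P)) (concat-rounds c r j) alt⊆)
      where P = q₁ ∷ q₂ ∷ ps

theorem5p6 : (c k : ℕ) → 2 ≤ c → 1 ≤ k →
    FwAtLeast (alt c (2 * k)) (k * (c + 2) ∸ 1) × FwAtLeast (alt c (2 * k + 1)) (k * (c + 2) + 1)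
theorem5p6 c zero    _   ()
theorem5p6 c (suc j) 2≤c _ =
  subst (FwAtLeast _) (sym even-bound) (avoiding⇒FwAtLeast (alt-even-avoided 2≤c j)) ,
  subst (FwAtLeast _) (+-comm 1 _) (avoiding⇒FwAtLeast (alt-odd-avoided 2≤c (suc j)))
  where
    even-bound : suc j * (c + 2) ∸ 1 ≡ suc (j * (c + 2) + c)
    even-bound = begin
      (c + 2 + j * (c + 2)) ∸ 1    ≡⟨ cong (_∸ 1) (+-assoc c 2 _) ⟩
      (c + suc (suc X)) ∸ 1        ≡⟨ cong (_∸ 1) (+-suc c (suc X)) ⟩
      c + suc X                    ≡⟨ +-suc c X ⟩
      suc (c + X)                  ≡⟨ cong suc (+-comm c X) ⟩
      suc (X + c)                  ∎
      where
        X : ℕ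
        X = j * (c + 2)
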